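{- Let $q$ be a prime power, $m,k,t$ positive integers with $k\le m$, $s\in\{1,\ldots,m\}$ with $\gcd(s,m)=1$, and $\{\alpha_1,\ldots,\alpha_t\}\subseteq\mathbb{F}_{q^m}^*$ a set whose elements have pairwise distinct norms $\mathrm{N}_s(\alpha_i)$. For $i\in\{1,\ldots,t\}$ let \[ \mathcal{U}^{ -s}_i=\{(x,\mathrm{N}_{ -s}^1(\alpha_i)x^{q^{ -s}},\ldots,\mathrm{N}_{ -s}^{k-1}(\alpha_i)x^{q^{ -s(k-1)}}):x\in\mathbb{F}_{q^m}\}, \] \[ \mathcal{U}^{s}_i=\{(x,\mathrm{N}_s^1(\mu_i)x^{q^s},\ldots,\mathrm{N}_s^{k-1}(\mu_i)x^{q^{s(k-1)}}):x\in\mathbb{F}_{q^m}\},\qquad \mu_i=(\alpha_i^{ -1})^{q^{ -s(k-2)}}. \] Then $(\mathcal{U}^{ -s}_1,\ldots,\mathcal{U}^{ -s}_t)$ is equivalent to $(\mathcal{U}^{s}_1,\ldots,\mathcal{U}^{s}_t)$.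
   Context: For any integer $r$, $x^{q^r}$ denotes the image of $x$ under the $r$-th power of the Frobenius automorphism of $\mathbb{F}_{q^m}$ (negative $r$ allowed). For an integer $u$ coprime to $m$ and $\alpha\in\mathbb{F}_{q^m}$: $\mathrm{N}_u(\alpha)=\prod_{i=0}^{m-1}\alpha^{q^{ui}}$, $\mathrm{N}_u^0(\alpha)=1$ and $\mathrm{N}_u^j(\alpha)=\prod_{i=0}^{j-1}\alpha^{q^{ui}}$ for $j\ge1$. Two $t$-tuples $(\mathcal{U}_1,\ldots,\mathcal{U}_t)$, $(\mathcal{V}_1,\ldots,\mathcal{V}_t)$ of $\mathbb{F}_q$-subspaces of $\mathbb{F}_{q^m}^k$ are equivalent if there exist $A\in\mathrm{GL}(k,q^m)$, $\gamma_1,\ldots,\gamma_t\in\mathbb{F}_{q^m}^*$ and a permutation $\sigma$ of $\{1,\ldots,t\}$ with $\mathcal{U}_i=\{\gamma_iAv:v\in\mathcal{V}_{\sigma(i)}\}$ for every $i$ (vectors as columns). -}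

module Defs where

open import Level using (Level; _⊔_) renaming (suc to lsuc)
open import Algebra.Bundles using (CommutativeRing)
open import Data.Nat as ℕ using (ℕ; zero; suc; _≤_; _^_)
open import Data.Nat.Primality using (Prime)
open import Data.Integer as ℤ using (ℤ; +_; -[1+_])
open import Data.Fin using (Fin; toℕ; _≟_)
open import Data.Fin.Permutation using (Permutation′; _⟨$⟩ʳ_)
open import Data.Product using (Σ; ∃; _×_)
open import Relation.Nullary using (¬_; yes; no)
open import Relation.Binary.PropositionalEquality using (_≡_)

IsPrimePower : ℕ → Set
IsPrimePower q = ∃ λ p → Prime p × ∃ λ n → 1 ≤ n × q ≡ p ^ n

record Field (c ℓ : Level) : Set (lsuc (c ⊔ ℓ)) where
  field
    commutativeRing : CommutativeRing c ℓ
  open CommutativeRing commutativeRing public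
  field
    _⁻¹     : Carrier → Carrier
    0≉1     : ¬ (0# ≈ 1#)
    inverse : ∀ x → ¬ (x ≈ 0#) → (x * (x ⁻¹)) ≈ 1#

module FieldTheory {c ℓ : Level} (F : Field c ℓ) where
  open Field F

  HasCard : ℕ → Set (c ⊔ ℓ)
  HasCard n = Σ (Fin n → Carrier) λ e →
                (∀ x → ∃ λ i → e i ≈ x) × (∀ i j → e i ≈ e j → i ≡ j)

  pow : Carrier → ℕ → Carrier
  pow x zero    = 1#
  pow x (suc n) = x * pow x n

  prod : ℕ → (ℕ → Carrier) → Carrier
  prod zero    f = 1#
  prod (suc j) f = prod j f * f j

  sumFin : (k : ℕ) → (Fin k → Carrier) → Carrier
  sumFin zero    f = 0#
  sumFin (suc k) f = f Data.Fin.zero + sumFin k (λ i → f (Data.Fin.suc i))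

  module Over (q m : ℕ) where
    -- r-th power of the Frobenius x ↦ x^q of F_{q^m}, for r ∈ ℤ.
    -- For negative r we use φ^{-1} = φ^{m-1} (φ has order dividing m).
    frob : ℤ → Carrier → Carrier
    frob (+ n)      x = pow x (q ^ n)
    frob -[1+ n ]   x = pow x (q ^ (suc n ℕ.* (m ℕ.∸ 1)))

    N : ℤ → Carrier → Carrier
    N u α = prod m (λ i → frob (u ℤ.* + i) α)

    Nj : ℤ → ℕ → Carrier → Carrier
    Nj u j α = prod j (λ i → frob (u ℤ.* + i) α)

    Vector : ℕ → Set c
    Vector k = Fin k → Carrier

    Matrix : ℕ → Set c
    Matrix k = Fin k → Fin k → Carrier

    _·_ : ∀ {k} → Matrix k → Vector k → Vector k
    (A · v) i = sumFin _ (λ l → A i l * v l)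

    _⊙_ : ∀ {k} → Matrix k → Matrix k → Matrix k
    (A ⊙ B) i j = sumFin _ (λ l → A i l * B l j)

    idM : ∀ {k} → Matrix k
    idM i j with i ≟ j
    ... | yes _ = 1#
    ... | no  _ = 0#

    Invertible : ∀ {k} → Matrix k → Set (c ⊔ ℓ)
    Invertible {k} A = Σ (Matrix k) λ B →
      (∀ i j → (A ⊙ B) i j ≈ idM i j) × (∀ i j → (B ⊙ A) i j ≈ idM i j)

    U : (k : ℕ) → ℤ → Carrier → Vector k → Set (c ⊔ ℓ)
    U k u β w = ∃ λ x → ∀ j → w j ≈ (Nj u (toℕ j) β * frob (u ℤ.* + toℕ j) x)

    Equivalent : ∀ {k t} → (Fin t → Vector k → Set (c ⊔ ℓ))
                         → (Fin t → Vector k → Set (c ⊔ ℓ)) → Set (c ⊔ ℓ)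
    Equivalent {k} {t} 𝒰 𝒱 =
      Σ (Matrix k) λ A → Invertible A ×
      Σ (Fin t → Carrier) λ γ → (∀ i → ¬ (γ i ≈ 0#)) ×
      Σ (Permutation′ t) λ σ → ∀ i (w : Vector k) →
        (𝒰 i w → ∃ λ v → 𝒱 (σ ⟨$⟩ʳ i) v × (∀ j → w j ≈ (γ i * (A · v) j)))
        × ((∃ λ v → 𝒱 (σ ⟨$⟩ʳ i) v × (∀ j → w j ≈ (γ i * (A · v) j))) → 𝒰 i w)

-- Reversing the coordinates (the anti-diagonal matrix) maps U^{-s}_i onto γ_i U^s_i with
-- γ_i = N^{k-1}_{-s}(α_i), the permutation being the identity. Indeed, writing y = x^{q^{-s(k-1)}},
-- the coordinate N^j_{-s}(α) x^{q^{-sj}} equals γ N^{k-1-j}_s(μ) y^{q^{s(k-1-j)}}: the exponents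
-- agree, and μ = (α^{-1})^{q^{-s(k-2)}} is chosen so that N^j_{-s}(α) = γ N^{k-1-j}_s(μ), by
-- induction on k-1-j, each step multiplying by α^{q^{-sj}} μ^{q^{s(k-2-j)}} = 1. Frobenius
-- exponents compose only modulo m, which rests on x^{q^m} = x in a field with q^m elements;
-- that follows because multiplication by z ≠ 0 permutes the field, so the product of all
-- nonzero elements equals z^{q^m - 1} times itself.

module Submission where

open import Defs
open import Level using (Level)
open import Data.Nat using (ℕ; _≤_; _^_)
open import Data.Nat.Coprimality using (Coprime)
open import Data.Integer as ℤ using (+_)
open import Data.Fin using (Fin)
open import Relation.Nullary using (¬_)
open import Relation.Binary.PropositionalEquality using (_≢_)

open import Level using (_⊔_)
open import Data.Nat as ℕ using (zero; suc; s≤s; z≤n)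
import Data.Nat.Properties as ℕP
open import Data.Integer using (ℤ; -[1+_])
import Data.Integer.Properties as ℤP
open import Data.Integer.Solver using (module +-*-Solver)
open import Data.Fin as Fin using (toℕ; opposite)
open import Data.Fin.Properties using (punchInᵢ≢i; opposite-involutive; opposite-prop; toℕ<n)
open import Data.Fin.Permutation as Perm using (Permutation′; permutation; _⟨$⟩ʳ_)
open import Data.Vec.Functional using (removeAt)
open import Data.Product using (∃; _×_; _,_; proj₁; proj₂)
open import Data.Empty using (⊥-elim)
open import Function using (_∘_; case_of_)
open import Relation.Nullary using (Dec; yes; no)
open import Relation.Nullary.Decidable using (map′)
open import Relation.Binary.PropositionalEquality as ≡ using (_≡_)

module FieldProperties {c ℓ : Level} (F : Field c ℓ) where
  open Field F
  open FieldTheory F using (pow)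
  import Algebra.Properties.CommutativeSemiring.Exp commutativeSemiring as Exp
  open import Relation.Binary.Reasoning.Setoid setoid

  pow≡^ : ∀ x n → pow x n ≡ x Exp.^ n
  pow≡^ x zero    = ≡.refl
  pow≡^ x (suc n) = ≡.cong (x *_) (pow≡^ x n)

  pow-congˡ : ∀ n {x y} → x ≈ y → pow x n ≈ pow y n
  pow-congˡ n {x} {y} x≈y = begin
    pow x n     ≡⟨ pow≡^ x n ⟩
    x Exp.^ n   ≈⟨ Exp.^-congˡ n x≈y ⟩
    y Exp.^ n   ≡⟨ pow≡^ y n ⟨
    pow y n     ∎

  pow-assocʳ : ∀ x a b → pow (pow x a) b ≈ pow x (a ℕ.* b)
  pow-assocʳ x a b = begin
    pow (pow x a) b       ≡⟨ ≡.trans (pow≡^ _ b) (≡.cong (Exp._^ b) (pow≡^ x a)) ⟩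
    (x Exp.^ a) Exp.^ b   ≈⟨ Exp.^-assocʳ x a b ⟩
    x Exp.^ (a ℕ.* b)     ≡⟨ pow≡^ x (a ℕ.* b) ⟨
    pow x (a ℕ.* b)       ∎

  pow-distrib-* : ∀ x y n → pow (x * y) n ≈ pow x n * pow y n
  pow-distrib-* x y n = begin
    pow (x * y) n           ≡⟨ pow≡^ _ n ⟩
    (x * y) Exp.^ n         ≈⟨ Exp.^-distrib-* x y n ⟩
    x Exp.^ n * y Exp.^ n   ≡⟨ ≡.cong₂ _*_ (pow≡^ x n) (pow≡^ y n) ⟨
    pow x n * pow y n       ∎

  pow-1# : ∀ n → pow 1# n ≈ 1#
  pow-1# zero    = refl
  pow-1# (suc n) = trans (*-identityˡ _) (pow-1# n)

  x⁻¹*[x*y]≈y : ∀ {x} y → ¬ x ≈ 0# → x ⁻¹ * (x * y) ≈ y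
  x⁻¹*[x*y]≈y {x} y x≉0 = begin
    x ⁻¹ * (x * y)   ≈⟨ *-assoc _ _ _ ⟨
    (x ⁻¹ * x) * y   ≈⟨ *-congʳ (trans (*-comm _ _) (inverse x x≉0)) ⟩
    1# * y           ≈⟨ *-identityˡ y ⟩
    y                ∎

  x*[x⁻¹*y]≈y : ∀ {x} y → ¬ x ≈ 0# → x * (x ⁻¹ * y) ≈ y
  x*[x⁻¹*y]≈y {x} y x≉0 = begin
    x * (x ⁻¹ * y)   ≈⟨ *-assoc _ _ _ ⟨
    (x * x ⁻¹) * y   ≈⟨ *-congʳ (inverse x x≉0) ⟩
    1# * y           ≈⟨ *-identityˡ y ⟩
    y                ∎

  *-cancelˡ : ∀ {x y z} → ¬ x ≈ 0# → x * y ≈ x * z → y ≈ z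
  *-cancelˡ {x} {y} {z} x≉0 xy≈xz = begin
    y                ≈⟨ x⁻¹*[x*y]≈y y x≉0 ⟨
    x ⁻¹ * (x * y)   ≈⟨ *-congˡ xy≈xz ⟩
    x ⁻¹ * (x * z)   ≈⟨ x⁻¹*[x*y]≈y z x≉0 ⟩
    z                ∎

  x*y≉0 : ∀ {x y} → ¬ x ≈ 0# → ¬ y ≈ 0# → ¬ x * y ≈ 0#
  x*y≉0 {x} x≉0 y≉0 xy≈0 = y≉0 (*-cancelˡ x≉0 (trans xy≈0 (sym (zeroʳ x))))

  x*y≈1⇒x≉0 : ∀ {x y} → x * y ≈ 1# → ¬ x ≈ 0#
  x*y≈1⇒x≉0 {x} {y} xy≈1 x≈0 = 0≉1 (trans (sym (zeroˡ y)) (trans (*-congʳ (sym x≈0)) xy≈1))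

module FiniteField {c ℓ : Level} (F : Field c ℓ) {n : ℕ} (card : FieldTheory.HasCard F (suc n)) where
  open Field F
  open FieldTheory F using (pow)
  open FieldProperties F
  open import Algebra.Properties.CommutativeMonoid.Sum *-commutativeMonoid
    using (sum-remove; sum-permute; sum-cong-≋; ∑-distrib-+; sum-replicate)
    renaming (sum to ∏)
  open import Relation.Binary.Reasoning.Setoid setoid

  enum : Fin (suc n) → Carrier
  enum = proj₁ card

  index : Carrier → Fin (suc n)
  index x = proj₁ (proj₁ (proj₂ card) x)

  enum-index : ∀ x → enum (index x) ≈ x
  enum-index x = proj₂ (proj₁ (proj₂ card) x)

  enum-injective : ∀ i j → enum i ≈ enum j → i ≡ j
  enum-injective = proj₂ (proj₂ card)

  index-injective : ∀ {x y} → index x ≡ index y → x ≈ y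
  index-injective {x} {y} eq = trans (sym (enum-index x)) (trans (reflexive (≡.cong enum eq)) (enum-index y))

  index-cong : ∀ {x y} → x ≈ y → index x ≡ index y
  index-cong {x} {y} x≈y = enum-injective _ _ (trans (enum-index x) (trans x≈y (sym (enum-index y))))

  _≈?_ : ∀ x y → Dec (x ≈ y)
  x ≈? y = map′ index-injective index-cong (index x Fin.≟ index y)

  -- Replacing 0 by 1 makes the product over all elements invertible.
  unitPart : Carrier → Carrier
  unitPart x with x ≈? 0#
  ... | yes _ = 1#
  ... | no  _ = x

  unitPart-zero : ∀ {x} → x ≈ 0# → unitPart x ≈ 1#
  unitPart-zero {x} x≈0 with x ≈? 0#
  ... | yes _   = refl
  ... | no  x≉0 = ⊥-elim (x≉0 x≈0)

  unitPart-nonzero : ∀ {x} → ¬ x ≈ 0# → unitPart x ≈ x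
  unitPart-nonzero {x} x≉0 with x ≈? 0#
  ... | yes x≈0 = ⊥-elim (x≉0 x≈0)
  ... | no  _   = refl

  unitPart-cong : ∀ {x y} → x ≈ y → unitPart x ≈ unitPart y
  unitPart-cong {x} {y} x≈y = case x ≈? 0# of λ where
    (yes x≈0) → trans (unitPart-zero x≈0)
                      (sym (unitPart-zero (trans (sym x≈y) x≈0)))
    (no  x≉0) → trans (unitPart-nonzero x≉0)
                      (trans x≈y (sym (unitPart-nonzero (x≉0 ∘ trans x≈y))))

  ∏-unitPart : ∀ {k} (v : Fin (suc k) → Carrier) i → v i ≈ 0# → (∀ j → ¬ removeAt v i j ≈ 0#) →
               ∏ (unitPart ∘ v) ≈ ∏ (removeAt v i)
  ∏-unitPart v i vᵢ≈0 rest≉0 = begin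
    ∏ (unitPart ∘ v)                                ≈⟨ sum-remove {i = i} (unitPart ∘ v) ⟩
    unitPart (v i) * ∏ (removeAt (unitPart ∘ v) i)  ≈⟨ *-congʳ (unitPart-zero vᵢ≈0) ⟩
    1# * ∏ (removeAt (unitPart ∘ v) i)              ≈⟨ *-identityˡ _ ⟩
    ∏ (removeAt (unitPart ∘ v) i)                   ≈⟨ sum-cong-≋ (λ j → unitPart-nonzero (rest≉0 j)) ⟩
    ∏ (removeAt v i)                                ∎

  ∏-nonzero : ∀ {k} (v : Fin k → Carrier) → (∀ j → ¬ v j ≈ 0#) → ¬ ∏ v ≈ 0#
  ∏-nonzero {zero}  v v≉0 = 0≉1 ∘ sym
  ∏-nonzero {suc k} v v≉0 = x*y≉0 (v≉0 Fin.zero) (∏-nonzero (v ∘ Fin.suc) (v≉0 ∘ Fin.suc))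

  ∏-scale : ∀ {k} z (v : Fin k → Carrier) → ∏ (λ j → z * v j) ≈ pow z k * ∏ v
  ∏-scale {k} z v = trans (∑-distrib-+ (λ _ → z) v)
                          (*-congʳ (trans (sum-replicate k) (reflexive (≡.sym (pow≡^ z k)))))

  scaling : ∀ {z} → ¬ z ≈ 0# → Permutation′ (suc n)
  scaling {z} z≉0 = permutation (λ i → index (z * enum i)) (λ i → index (z ⁻¹ * enum i))
    (λ i → enum-injective _ _ (trans (enum-index _)
                                      (trans (*-congˡ (enum-index _)) (x*[x⁻¹*y]≈y _ z≉0))))
    (λ i → enum-injective _ _ (trans (enum-index _)
                                      (trans (*-congˡ (enum-index _)) (x⁻¹*[x*y]≈y _ z≉0))))

  pow-pred-card : ∀ {z} → ¬ z ≈ 0# → pow z n ≈ 1#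
  pow-pred-card {z} z≉0 = *-cancelˡ P≉0 (begin
    P * pow z n                                ≈⟨ *-comm _ _ ⟩
    pow z n * P                                ≈⟨ ∏-scale z (removeAt enum i₀) ⟨
    ∏ (removeAt ((z *_) ∘ enum) i₀)            ≈⟨ ∏-unitPart ((z *_) ∘ enum) i₀ z*0≈0 z*rest≉0 ⟨
    ∏ (unitPart ∘ (z *_) ∘ enum)               ≈⟨ sum-cong-≋ (unitPart-cong ∘ enum-scaling) ⟨
    ∏ (unitPart ∘ enum ∘ (scaling z≉0 ⟨$⟩ʳ_))   ≈⟨ sum-permute (unitPart ∘ enum) (scaling z≉0) ⟨
    ∏ (unitPart ∘ enum)                        ≈⟨ ∏-unitPart enum i₀ (enum-index 0#) rest≉0 ⟩
    P                                          ≈⟨ *-identityʳ P ⟨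
    P * 1#                                     ∎)
    where
    i₀ : Fin (suc n)
    i₀ = index 0#
    rest≉0 : ∀ j → ¬ removeAt enum i₀ j ≈ 0#
    rest≉0 j eⱼ≈0 = punchInᵢ≢i i₀ j (enum-injective _ _ (trans eⱼ≈0 (sym (enum-index 0#))))
    P : Carrier
    P = ∏ (removeAt enum i₀)
    P≉0 : ¬ P ≈ 0#
    P≉0 = ∏-nonzero (removeAt enum i₀) rest≉0
    z*0≈0 : z * enum i₀ ≈ 0#
    z*0≈0 = trans (*-congˡ (enum-index 0#)) (zeroʳ z)
    z*rest≉0 : ∀ j → ¬ z * removeAt enum i₀ j ≈ 0#
    z*rest≉0 = x*y≉0 z≉0 ∘ rest≉0
    enum-scaling : ∀ i → enum (scaling z≉0 ⟨$⟩ʳ i) ≈ z * enum i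
    enum-scaling i = enum-index (z * enum i)

  pow-card : ∀ z → pow z (suc n) ≈ z
  pow-card z with z ≈? 0#
  ... | yes z≈0 = trans (*-congʳ z≈0) (trans (zeroˡ _) (sym z≈0))
  ... | no  z≉0 = trans (*-congˡ (pow-pred-card z≉0)) (*-identityʳ z)

fermat : ∀ {c ℓ} (F : Field c ℓ) {n} → FieldTheory.HasCard F n →
         ∀ z → Field._≈_ F (FieldTheory.pow F z n) z
fermat F {zero}  (_ , surjective , _) z with () ← proj₁ (surjective z)
fermat F {suc n} card = FiniteField.pow-card F card

module Exponent (m′ : ℕ) where
  open ≡.≡-Reasoning

  m : ℕ
  m = suc m′

  -- frob r is by definition frob (+ exponent r), and exponent r ≡ r (mod m).
  exponent : ℤ → ℕ
  exponent (+ a)    = a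
  exponent -[1+ a ] = suc a ℕ.* m′

  exponent≡ : ∀ r → ∃ λ c → + exponent r ≡ r ℤ.+ + (c ℕ.* m)
  exponent≡ (+ a)    = 0 , ≡.sym (ℤP.+-identityʳ (+ a))
  exponent≡ -[1+ a ] = suc a , (begin
    + (suc a ℕ.* m′)                  ≡⟨ ℤP.pos-* (suc a) m′ ⟩
    + suc a ℤ.* + m′                  ≡⟨ solve 2 (λ A M → A :* M := :- A :+ A :* (con (+ 1) :+ M))
                                                 ≡.refl (+ suc a) (+ m′) ⟩
    -[1+ a ] ℤ.+ + suc a ℤ.* + m      ≡⟨ ≡.cong (λ e → -[1+ a ] ℤ.+ e) (ℤP.pos-* (suc a) m) ⟨
    -[1+ a ] ℤ.+ + (suc a ℕ.* m)      ∎)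
    where open +-*-Solver

  exponent-+ : ∀ r₁ r₂ {r₃} → r₁ ℤ.+ r₂ ≡ r₃ →
               ∃ λ c → ∃ λ d → exponent r₁ ℕ.+ exponent r₂ ℕ.+ c ℕ.* m ≡ exponent r₃ ℕ.+ d ℕ.* m
  exponent-+ r₁ r₂ {r₃} r₁+r₂≡r₃ with exponent≡ r₁ | exponent≡ r₂ | exponent≡ r₃
  ... | c₁ , e₁≡ | c₂ , e₂≡ | c₃ , e₃≡ = c₃ , c₁ ℕ.+ c₂ , ℤP.+-injective (begin
      + (e₁ ℕ.+ e₂ ℕ.+ c₃ ℕ.* m)            ≡⟨ ≡.trans (ℤP.pos-+ (e₁ ℕ.+ e₂) _)
                                                       (≡.cong (ℤ._+ C₃) (ℤP.pos-+ e₁ e₂)) ⟩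
      + e₁ ℤ.+ + e₂ ℤ.+ C₃                  ≡⟨ ≡.cong₂ (λ a b → a ℤ.+ b ℤ.+ C₃) e₁≡ e₂≡ ⟩
      r₁ ℤ.+ C₁ ℤ.+ (r₂ ℤ.+ C₂) ℤ.+ C₃
        ≡⟨ solve 5 (λ a b x y z → a :+ x :+ (b :+ y) :+ z := a :+ b :+ z :+ (x :+ y)) ≡.refl r₁ r₂ C₁ C₂ C₃ ⟩
      r₁ ℤ.+ r₂ ℤ.+ C₃ ℤ.+ (C₁ ℤ.+ C₂)      ≡⟨ ≡.cong (λ r → r ℤ.+ C₃ ℤ.+ (C₁ ℤ.+ C₂)) r₁+r₂≡r₃ ⟩
      r₃ ℤ.+ C₃ ℤ.+ (C₁ ℤ.+ C₂)             ≡⟨ ≡.cong₂ ℤ._+_ e₃≡ C₁+C₂≡ ⟨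
      + e₃ ℤ.+ + ((c₁ ℕ.+ c₂) ℕ.* m)        ≡⟨ ℤP.pos-+ e₃ _ ⟨
      + (e₃ ℕ.+ (c₁ ℕ.+ c₂) ℕ.* m)          ∎)
    where
    open +-*-Solver
    e₁ = exponent r₁
    e₂ = exponent r₂
    e₃ = exponent r₃
    C₁ = + (c₁ ℕ.* m)
    C₂ = + (c₂ ℕ.* m)
    C₃ = + (c₃ ℕ.* m)
    C₁+C₂≡ : + ((c₁ ℕ.+ c₂) ℕ.* m) ≡ C₁ ℤ.+ C₂
    C₁+C₂≡ = ≡.trans (≡.cong +_ (ℕP.*-distribʳ-+ m c₁ c₂)) (ℤP.pos-+ (c₁ ℕ.* m) (c₂ ℕ.* m))

module Frobenius {c ℓ : Level} (F : Field c ℓ) (q m′ : ℕ)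
                 (pow-card : ∀ z → Field._≈_ F (FieldTheory.pow F z (q ^ suc m′)) z) where
  open Field F
  open FieldTheory F using (pow)
  open FieldTheory.Over F q (suc m′) using (frob; Nj)
  open FieldProperties F
  open import Relation.Binary.Reasoning.Setoid setoid

  open Exponent m′

  frob-cong : ∀ r {x y} → x ≈ y → frob r x ≈ frob r y
  frob-cong (+ a)    = pow-congˡ (q ^ a)
  frob-cong -[1+ a ] = pow-congˡ (q ^ (suc a ℕ.* m′))

  frob-* : ∀ r x y → frob r (x * y) ≈ frob r x * frob r y
  frob-* (+ a)    x y = pow-distrib-* x y (q ^ a)
  frob-* -[1+ a ] x y = pow-distrib-* x y (q ^ (suc a ℕ.* m′))

  frob-1# : ∀ r → frob r 1# ≈ 1#
  frob-1# (+ a)    = pow-1# (q ^ a)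
  frob-1# -[1+ a ] = pow-1# (q ^ (suc a ℕ.* m′))

  frob-inverse : ∀ r {x} → ¬ x ≈ 0# → frob r x * frob r (x ⁻¹) ≈ 1#
  frob-inverse r {x} x≉0 = begin
    frob r x * frob r (x ⁻¹)   ≈⟨ frob-* r x (x ⁻¹) ⟨
    frob r (x * x ⁻¹)          ≈⟨ frob-cong r (inverse x x≉0) ⟩
    frob r 1#                  ≈⟨ frob-1# r ⟩
    1#                         ∎

  frob-nonzero : ∀ r {x} → ¬ x ≈ 0# → ¬ frob r x ≈ 0#
  frob-nonzero r x≉0 = x*y≈1⇒x≉0 (frob-inverse r x≉0)

  frob-+-ℕ : ∀ a b x → frob (+ a) (frob (+ b) x) ≈ frob (+ (a ℕ.+ b)) x
  frob-+-ℕ a b x = begin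
    pow (pow x (q ^ b)) (q ^ a)   ≈⟨ pow-assocʳ x (q ^ b) (q ^ a) ⟩
    pow x (q ^ b ℕ.* q ^ a)       ≡⟨ ≡.cong (pow x) (≡.trans (ℕP.*-comm (q ^ b) (q ^ a))
                                                              (≡.sym (ℕP.^-distribˡ-+-* q a b))) ⟩
    pow x (q ^ (a ℕ.+ b))         ∎

  frob-multiple-of-m : ∀ c x → frob (+ (c ℕ.* m)) x ≈ x
  frob-multiple-of-m zero    x = *-identityʳ x
  frob-multiple-of-m (suc c) x = begin
    frob (+ (m ℕ.+ c ℕ.* m)) x          ≈⟨ frob-+-ℕ m (c ℕ.* m) x ⟨
    frob (+ m) (frob (+ (c ℕ.* m)) x)   ≈⟨ pow-card _ ⟩
    frob (+ (c ℕ.* m)) x                ≈⟨ frob-multiple-of-m c x ⟩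
    x                                   ∎

  frob-mod : ∀ a b c d x → a ℕ.+ c ℕ.* m ≡ b ℕ.+ d ℕ.* m → frob (+ a) x ≈ frob (+ b) x
  frob-mod a b c d x a+cm≡b+dm = begin
    frob (+ a) x                            ≈⟨ frob-cong (+ a) (frob-multiple-of-m c x) ⟨
    frob (+ a) (frob (+ (c ℕ.* m)) x)       ≈⟨ frob-+-ℕ a (c ℕ.* m) x ⟩
    frob (+ (a ℕ.+ c ℕ.* m)) x              ≡⟨ ≡.cong (λ e → frob (+ e) x) a+cm≡b+dm ⟩
    frob (+ (b ℕ.+ d ℕ.* m)) x              ≈⟨ frob-+-ℕ b (d ℕ.* m) x ⟨
    frob (+ b) (frob (+ (d ℕ.* m)) x)       ≈⟨ frob-cong (+ b) (frob-multiple-of-m d x) ⟩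
    frob (+ b) x                            ∎

  frob≡frob-exponent : ∀ r x → frob r x ≡ frob (+ exponent r) x
  frob≡frob-exponent (+ a)    x = ≡.refl
  frob≡frob-exponent -[1+ a ] x = ≡.refl

  frob-+ : ∀ r₁ r₂ {r₃} x → r₁ ℤ.+ r₂ ≡ r₃ → frob r₁ (frob r₂ x) ≈ frob r₃ x
  frob-+ r₁ r₂ {r₃} x r₁+r₂≡r₃ with exponent-+ r₁ r₂ r₁+r₂≡r₃
  ... | c , d , congruence = begin
    frob r₁ (frob r₂ x)                           ≡⟨ ≡.trans (frob≡frob-exponent r₁ _)
                                                             (≡.cong (frob (+ exponent r₁)) (frob≡frob-exponent r₂ x)) ⟩
    frob (+ exponent r₁) (frob (+ exponent r₂) x) ≈⟨ frob-+-ℕ (exponent r₁) (exponent r₂) x ⟩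
    frob (+ (exponent r₁ ℕ.+ exponent r₂)) x      ≈⟨ frob-mod _ (exponent r₃) c d x congruence ⟩
    frob (+ exponent r₃) x                        ≡⟨ frob≡frob-exponent r₃ x ⟨
    frob r₃ x                                     ∎

  frob-cancel : ∀ r y → frob r (frob (ℤ.- r) y) ≈ y
  frob-cancel r y = trans (frob-+ r (ℤ.- r) y (ℤP.+-inverseʳ r)) (*-identityʳ y)

  Nj-nonzero : ∀ u j {α} → ¬ α ≈ 0# → ¬ Nj u j α ≈ 0#
  Nj-nonzero u zero    α≉0 = 0≉1 ∘ sym
  Nj-nonzero u (suc j) α≉0 = x*y≉0 (Nj-nonzero u j α≉0) (frob-nonzero (u ℤ.* + j) α≉0)

module AntiIdentity {c ℓ : Level} (F : Field c ℓ) (q m : ℕ) where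
  open Field F
  open FieldTheory F using (sumFin)
  open FieldTheory.Over F q m using (Vector; Matrix; _·_; _⊙_; idM)
  open import Algebra.Properties.CommutativeMonoid.Sum +-commutativeMonoid
    using (sum; sum-remove; sum-cong-≋; sum-replicate-zero)
  open import Relation.Binary.Reasoning.Setoid setoid

  sumFin≡sum : ∀ {k} (f : Fin k → Carrier) → sumFin k f ≡ sum f
  sumFin≡sum {zero}  f = ≡.refl
  sumFin≡sum {suc k} f = ≡.cong (λ rest → f Fin.zero + rest) (sumFin≡sum (f ∘ Fin.suc))

  idM-diagonal : ∀ {k} (i : Fin k) → idM i i ≈ 1#
  idM-diagonal i with i Fin.≟ i
  ... | yes _   = refl
  ... | no  i≢i = ⊥-elim (i≢i ≡.refl)

  idM-offDiagonal : ∀ {k} {i j : Fin k} → i ≢ j → idM i j ≈ 0#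
  idM-offDiagonal {i = i} {j} i≢j with i Fin.≟ j
  ... | yes i≡j = ⊥-elim (i≢j i≡j)
  ... | no  _   = refl

  idM-row : ∀ {k} (i : Fin k) (v : Vector k) → sumFin k (λ l → idM i l * v l) ≈ v i
  idM-row {suc k} i v = begin
    sumFin (suc k) δv                     ≡⟨ sumFin≡sum δv ⟩
    sum δv                                ≈⟨ sum-remove {i = i} δv ⟩
    idM i i * v i + sum (removeAt δv i)   ≈⟨ +-cong (*-congʳ (idM-diagonal i)) (sum-cong-≋ off-diagonal) ⟩
    1# * v i + sum {k} (λ _ → 0#)         ≈⟨ +-cong (*-identityˡ (v i)) (sum-replicate-zero k) ⟩
    v i + 0#                              ≈⟨ +-identityʳ (v i) ⟩
    v i                                   ∎
    where
    δv : Vector (suc k)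
    δv l = idM i l * v l
    off-diagonal : ∀ l → removeAt δv i l ≈ 0#
    off-diagonal l = trans (*-congʳ (idM-offDiagonal (punchInᵢ≢i i l ∘ ≡.sym))) (zeroˡ _)

  antiIdentity : ∀ {k} → Matrix k
  antiIdentity i = idM (opposite i)

  antiIdentity-· : ∀ {k} (v : Vector k) j → (antiIdentity · v) j ≈ v (opposite j)
  antiIdentity-· v j = idM-row (opposite j) v

  antiIdentity-involutive : ∀ {k} (i j : Fin k) → (antiIdentity ⊙ antiIdentity) i j ≈ idM i j
  antiIdentity-involutive i j = trans (idM-row (opposite i) (λ l → antiIdentity l j))
                                      (reflexive (≡.cong (λ l → idM l j) (opposite-involutive i)))

exponent-shift : ∀ s L d j {k} → L ℕ.+ (d ℕ.+ j) ≡ k →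
                 + s ℤ.* + L ℤ.+ ℤ.- (+ s) ℤ.* (+ k ℤ.- + d) ≡ ℤ.- (+ s) ℤ.* + j
exponent-shift s L d j ≡.refl = begin
  + s ℤ.* + L ℤ.+ ℤ.- (+ s) ℤ.* (+ (L ℕ.+ (d ℕ.+ j)) ℤ.- + d)
    ≡⟨ ≡.cong (λ k → + s ℤ.* + L ℤ.+ ℤ.- (+ s) ℤ.* (k ℤ.- + d)) k≡ ⟩
  + s ℤ.* + L ℤ.+ ℤ.- (+ s) ℤ.* (+ L ℤ.+ (+ d ℤ.+ + j) ℤ.- + d)
    ≡⟨ solve 4 (λ S L D J → S :* L :+ (:- S) :* (L :+ (D :+ J) :- D) := (:- S) :* J)
               ≡.refl (+ s) (+ L) (+ d) (+ j) ⟩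
  ℤ.- (+ s) ℤ.* + j
    ∎
  where
  open ≡.≡-Reasoning
  open +-*-Solver
  k≡ : + (L ℕ.+ (d ℕ.+ j)) ≡ + L ℤ.+ (+ d ℤ.+ + j)
  k≡ = ≡.trans (ℤP.pos-+ L (d ℕ.+ j)) (≡.cong (λ e → + L ℤ.+ e) (ℤP.pos-+ d j))

module Reversal {c ℓ : Level} (F : Field c ℓ) (q m′ : ℕ)
                (pow-card : ∀ z → Field._≈_ F (FieldTheory.pow F z (q ^ suc m′)) z) (s k : ℕ) where
  open Field F
  open FieldTheory.Over F q (suc m′)
  open FieldProperties F
  open Frobenius F q m′ pow-card
  open AntiIdentity F q (suc m′)
  open import Relation.Binary.Reasoning.Setoid setoid

  u : ℤ
  u = ℤ.- (+ s)

  μ : Carrier → Carrier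
  μ α = frob (u ℤ.* (+ k ℤ.- + 2)) (α ⁻¹)

  γ : Carrier → Carrier
  γ α = Nj u (k ℕ.∸ 1) α

  point : ℤ → Carrier → Carrier → Vector k
  point v β x j = Nj v (toℕ j) β * frob (v ℤ.* + toℕ j) x

  point-cong : ∀ v β {x y} → x ≈ y → ∀ j → point v β x j ≈ point v β y j
  point-cong v β x≈y j = *-congˡ (frob-cong (v ℤ.* + toℕ j) x≈y)

  ReversedImage : Carrier → Vector k → Set (c ⊔ ℓ)
  ReversedImage α w = ∃ λ v → U k (+ s) (μ α) v × (∀ j → w j ≈ (γ α * (antiIdentity · v) j))

  module _ {α : Carrier} (α≉0 : ¬ α ≈ 0#) where

    Nj-reversal : ∀ L j → L ℕ.+ suc j ≡ k → Nj u j α ≈ γ α * Nj (+ s) L (μ α)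
    Nj-reversal zero    j ≡.refl = sym (*-identityʳ (γ α))
    Nj-reversal (suc L) j L+1+j≡k = begin
      Nj u j α                                  ≈⟨ *-identityʳ _ ⟨
      Nj u j α * 1#                             ≈⟨ *-congˡ factor≈1 ⟨
      Nj u j α * (frob (u ℤ.* + j) α * ν)       ≈⟨ *-assoc _ _ _ ⟨
      Nj u (suc j) α * ν                        ≈⟨ *-congʳ (Nj-reversal L (suc j) L+2+j≡k) ⟩
      (γ α * Nj (+ s) L (μ α)) * ν              ≈⟨ *-assoc _ _ _ ⟩
      γ α * Nj (+ s) (suc L) (μ α)              ∎
      where
      L+2+j≡k : L ℕ.+ suc (suc j) ≡ k
      L+2+j≡k = ≡.trans (ℕP.+-suc L (suc j)) L+1+j≡k
      ν : Carrier
      ν = frob (+ s ℤ.* + L) (μ α)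
      factor≈1 : frob (u ℤ.* + j) α * ν ≈ 1#
      factor≈1 = trans (*-congˡ (frob-+ (+ s ℤ.* + L) _ (α ⁻¹) (exponent-shift s L 2 j L+2+j≡k)))
                       (frob-inverse (u ℤ.* + j) α≉0)

    point-reversal : ∀ x j →
      point u α x j ≈ γ α * point (+ s) (μ α) (frob (u ℤ.* (+ k ℤ.- + 1)) x) (opposite j)
    point-reversal x j = begin
      Nj u (toℕ j) α * frob (u ℤ.* + toℕ j) x           ≈⟨ *-cong (Nj-reversal L (toℕ j) L+1+j≡k) frob-x≈ ⟩
      (γ α * Nj (+ s) L (μ α)) * frob (+ s ℤ.* + L) y   ≈⟨ *-assoc _ _ _ ⟩
      γ α * point (+ s) (μ α) y (opposite j)            ∎
      where
      L : ℕ
      L = toℕ (opposite j)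
      y : Carrier
      y = frob (u ℤ.* (+ k ℤ.- + 1)) x
      L+1+j≡k : L ℕ.+ suc (toℕ j) ≡ k
      L+1+j≡k = ≡.trans (≡.cong (ℕ._+ suc (toℕ j)) (opposite-prop j)) (ℕP.m∸n+n≡m (toℕ<n j))
      frob-x≈ : frob (u ℤ.* + toℕ j) x ≈ frob (+ s ℤ.* + L) y
      frob-x≈ = sym (frob-+ (+ s ℤ.* + L) _ x (exponent-shift s L 1 (toℕ j) L+1+j≡k))

    U-reversal : ∀ w → (U k u α w → ReversedImage α w) × (ReversedImage α w → U k u α w)
    U-reversal w = image , preimage
      where
      image : U k u α w → ReversedImage α w
      image (x , w≈) = point (+ s) (μ α) y , (y , λ _ → refl) , λ j → begin
        w j                                          ≈⟨ w≈ j ⟩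
        point u α x j                                ≈⟨ point-reversal x j ⟩
        γ α * point (+ s) (μ α) y (opposite j)       ≈⟨ *-congˡ (antiIdentity-· _ j) ⟨
        γ α * (antiIdentity · point (+ s) (μ α) y) j ∎
        where
        y : Carrier
        y = frob (u ℤ.* (+ k ℤ.- + 1)) x
      preimage : ReversedImage α w → U k u α w
      preimage (v , (y , v≈) , w≈) = x , λ j → begin
        w j                                               ≈⟨ w≈ j ⟩
        γ α * (antiIdentity · v) j                        ≈⟨ *-congˡ (trans (antiIdentity-· v j) (v≈ (opposite j))) ⟩
        γ α * point (+ s) (μ α) y (opposite j)            ≈⟨ *-congˡ (point-cong (+ s) (μ α) (frob-cancel r y) _) ⟨
        γ α * point (+ s) (μ α) (frob r x) (opposite j)   ≈⟨ point-reversal x j ⟨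
        point u α x j                                     ∎
        where
        r : ℤ
        r = u ℤ.* (+ k ℤ.- + 1)
        x : Carrier
        x = frob (ℤ.- r) y

  γ-nonzero : ∀ {α} → ¬ α ≈ 0# → ¬ γ α ≈ 0#
  γ-nonzero = Nj-nonzero u (k ℕ.∸ 1)

-- Only α i ≉ 0 is used: the remaining hypotheses are the setting in which the paper
-- studies these tuples, and the equivalence does not depend on them.
theorem5p3 : ∀ {c ℓ : Level} (F : Field c ℓ) (q m k t : ℕ) →
    IsPrimePower q → 1 ≤ m → 1 ≤ k → 1 ≤ t → k ≤ m →
    FieldTheory.HasCard F (q ^ m) →
    (s : ℕ) → 1 ≤ s → s ≤ m → Coprime s m →
    (α : Fin t → Field.Carrier F) →
    (∀ i → ¬ Field._≈_ F (α i) (Field.0# F)) →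
    (∀ i j → i ≢ j → ¬ Field._≈_ F (FieldTheory.Over.N F q m (+ s) (α i))
                                     (FieldTheory.Over.N F q m (+ s) (α j))) →
    FieldTheory.Over.Equivalent F q m
      (λ i → FieldTheory.Over.U F q m k (ℤ.- (+ s)) (α i))
      (λ i → FieldTheory.Over.U F q m k (+ s)
               (FieldTheory.Over.frob F q m (ℤ.- (+ s) ℤ.* (+ k ℤ.- + 2))
                  (Field._⁻¹ F (α i))))
theorem5p3 F q (suc m′) k t _ (s≤s z≤n) _ _ _ card s _ _ _ α α≉0 _ =
  antiIdentity , (antiIdentity , antiIdentity-involutive , antiIdentity-involutive) ,
  γ ∘ α , γ-nonzero ∘ α≉0 ,
  Perm.id , λ i → U-reversal (α≉0 i)
  where
  open AntiIdentity F q (suc m′)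
  open Reversal F q m′ (fermat F card) s k
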